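{- Let $p$ be an odd prime, $b\in\overline{\mathbb{F}}_p^\times$, and let $\mathcal{H}_2$, $\mathscr{A}^{\mathrm{nil}}$, $\mathscr{A}_2$, the module $M_b$, the elements $1_1,1_2$, the subalgebra $\mathcal{H}_{2,\mathrm{aff}}$ and the characters $\chi_1,\chi_2$ be as in the context. For $i=1,2$ and every $h\in\mathcal{H}_{2,\mathrm{aff}}$, one has $h\cdot 1_i=\chi_i(h)\,1_i$ in $M_b$. That is, $\mathcal{H}_{2,\mathrm{aff}}$ acts on $1_i$ by the supersingular character $\chi_i$.
   Context: Let $\Lambda=\mathbb{Z}^2$, $W_0=\{1,s\}$ with $s$ swapping the coordinates, and $W=e^\Lambda\rtimes W_0$. Put $$u=e^{(1,0)}s,\qquad s_0=e^{(1,-1)}s.$$ The group $W_{\mathrm{aff}}=e^{\mathbb{Z}(1,-1)}\rtimes W_0$ is Coxeter with generators $s_0,s$, and its length $\ell$ is extended to $W=W_{\mathrm{aff}}\rtimes u^{\mathbb{Z}}$ by $\ell(u)=0$. Let $k=\overline{\mathbb{F}}_p$. The nil Hecke algebra $\mathcal{H}^{\mathrm{nil}}$ over $k$ has basis $\{T_w\}_{w\in W}$, with $T_wT_{w'}=T_{ww'}$ if lengths add and $T_s^2=T_{s_0}^2=0$. Put $$S=T_s,\qquad U=T_u,\qquad S_0=T_{s_0}=USU^{ -1}.$$ $W$ acts on $\{1,2\}$ via $W\to W_0$, with $s$ swapping $1,2$; write ${}^s i$ for the other index. $\mathcal{H}_2=(k\varepsilon_1\times k\varepsilon_2)\otimes_k\mathcal{H}^{\mathrm{nil}}$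 with multiplication $$(\varepsilon_i\otimes T_w)(\varepsilon_{i'}\otimes T_{w'})=\varepsilon_i\varepsilon_{{}^wi'}\otimes T_wT_{w'}.$$ $\mathcal{H}_{2,\mathrm{aff}}$ is its subalgebra generated by $\varepsilon_1,\varepsilon_2,S_0,S$. The character $\chi_i$ of $\mathcal{H}_{2,\mathrm{aff}}$ is defined by $$\chi_i(\varepsilon_i)=1,\qquad \chi_i(\varepsilon_{{}^si})=0,\qquad \chi_i(S_0)=\chi_i(S)=0.$$ Let $P=k[\eta_1,\eta_2]$ with $s$ swapping $\eta_1,\eta_2$, and set $\xi_1=\eta_1+\eta_2$, $\xi_2=\eta_1\eta_2$. Let $D_s(a)=\dfrac{a-s(a)}{\eta_1-\eta_2}$. $\mathscr{A}^{\mathrm{nil}}:\mathcal{H}^{\mathrm{nil}}\to\mathrm{End}_{k[\xi_1,\xi_2^{\pm1}]}(P[\xi_2^{ -1}])$ is the ring homomorphism with: - $S\mapsto -D_s$; - $U\mapsto$ the operator with matrix $$\begin{pmatrix}\frac{\xi_1^2}{2}-\xi_2 & -\xi_1(\frac{\xi_1^2}{4}-\xi_2)\\ \xi_1 & -(\frac{\xi_1^2}{2}-\xi_2)\end{pmatrix}$$ in the basis $\{1,\frac{\eta_1-\eta_2}{2}\}$ (columns are the images). $\mathscr{A}_2:\mathcal{H}_2\to\mathrm{End}(P[\xi_2^{ -1}]\times P[\xi_2^{ -1}])$ is the ring homomorphism with $$\mathscr{A}_2(\varepsilon_iT_w)=p_i\circ\mathrm{diag}(\mathscr{A}^{\mathrm{nil}}(T_w))\circ\mathrm{perm}(w),$$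 where: - $\mathrm{diag}(X)$ applies $X$ in both factors; - $\mathrm{perm}(w)$ swaps the two factors if $w$ maps to $s$ and is the identity otherwise; - $p_i$ is the projection onto the $i$-th factor, viewed as an endomorphism. The elements $\zeta_1=US+SU$ and $\zeta_2=U^2$ act by $-\xi_1$ and $\xi_2^2$, respectively. Define the $\mathcal{H}_2$-module $$M_b=\big(P[\xi_2^{ -1}]\times P[\xi_2^{ -1}]\big)\otimes_{k[\zeta_1,\zeta_2^{\pm1}]}k,$$ where $\zeta_1\mapsto0$ and $\zeta_2\mapsto b$. Equivalently, $M_b$ is the quotient by the ideal generated by $\xi_1$ and $\xi_2^2-b$; this is the reduction along a supersingular central character $\theta$ with $\theta(\zeta_2)=b$. Let $1_1=(1,0)$ and $1_2=(0,1)$ in $M_b$. -}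

module Defs where

open import Level using (Level; _⊔_)
open import Algebra.Bundles using (CommutativeRing)
open import Data.Nat as ℕ using (ℕ; zero; suc; _<ᵇ_; _∸_)
import Data.Fin
import Relation.Nullary
open import Data.Nat.Primality using (Prime)
open import Data.Bool using (Bool; true; false; if_then_else_; _∧_)
open import Data.List using (List; []; _∷_)
open import Data.Product using (Σ; ∃; _×_; _,_)
open import Data.Fin as Fin using (Fin)
open import Relation.Nullary using (¬_)
open import Relation.Binary.PropositionalEquality using () renaming (_≡_ to _≡ℕ_)

module RingHelpers {c ℓ : Level} (R : CommutativeRing c ℓ) where
  open CommutativeRing R

  pow : Carrier → ℕ → Carrier
  pow x zero    = 1#
  pow x (suc n) = x * pow x n

  natR : ℕ → Carrier
  natR zero    = 0#
  natR (suc n) = 1# + natR n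

  sumTo : ℕ → (ℕ → Carrier) → Carrier
  sumTo zero    f = 0#
  sumTo (suc n) f = sumTo n f + f n

  -- evaluation of the monic polynomial x^n + c_{n-1} x^{n-1} + ... + c_0,
  -- where the list is [c_0 , c_1 , ... , c_{n-1}] (n = its length)
  evalMonic : List Carrier → Carrier → Carrier
  evalMonic []       x = 1#
  evalMonic (a ∷ as) x = a + x * evalMonic as x

record IsField {c ℓ : Level} (R : CommutativeRing c ℓ) : Set (c ⊔ ℓ) where
  open CommutativeRing R
  field
    nontrivial : ¬ (1# ≈ 0#)
    invertible : ∀ x → ¬ (x ≈ 0#) → ∃ λ y → x * y ≈ 1#

-- k has characteristic p (p prime, so the characteristic is exactly p)
HasChar : {c ℓ : Level} → CommutativeRing c ℓ → ℕ → Set ℓ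
HasChar R p = natR p ≈ 0#
  where open CommutativeRing R
        open RingHelpers R

-- k is algebraically closed: every monic polynomial of positive degree has a root
IsAlgClosed : {c ℓ : Level} → CommutativeRing c ℓ → Set (c ⊔ ℓ)
IsAlgClosed R = ∀ (a : Carrier) (as : List Carrier) →
                  ∃ λ x → evalMonic (a ∷ as) x ≈ 0#
  where open CommutativeRing R
        open RingHelpers R

-- k is algebraic over F_p: every element lies in some F_{p^n}
IsAlgebraicOverFp : {c ℓ : Level} → CommutativeRing c ℓ → ℕ → Set (c ⊔ ℓ)
IsAlgebraicOverFp R p = ∀ x → ∃ λ n → pow x (p ℕ.^ suc n) ≈ x
  where open CommutativeRing R
        open RingHelpers R

record IsAlgClosureOfFp {c ℓ : Level} (R : CommutativeRing c ℓ) (p : ℕ) : Set (c ⊔ ℓ) where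
  field
    isField   : IsField R
    prime     : Prime p
    odd       : ¬ (p ≡ℕ 2)
    char      : HasChar R p
    algClosed : IsAlgClosed R
    algebraic : IsAlgebraicOverFp R p

-- Parameters: the ring k, an element half with half * 2 = 1, and b.

module Construction {c ℓ : Level} (R : CommutativeRing c ℓ) (half b : CommutativeRing.Carrier R) where
  open CommutativeRing R
  open RingHelpers R

  -- Polynomials in η₁, η₂: a coefficient function together with a bound;
  -- the coefficient of η₁^i η₂^j is  coeff f i j  (zero unless i,j < deg).
  record Poly : Set c where
    constructor poly
    field
      deg : ℕ
      cf  : ℕ → ℕ → Carrier

  open Poly public

  coeff : Poly → ℕ → ℕ → Carrier
  coeff f i j = if (i <ᵇ deg f) ∧ (j <ᵇ deg f) then cf f i j else 0#

  _≈P_ : Poly → Poly → Set ℓ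
  f ≈P g = ∀ i j → coeff f i j ≈ coeff g i j

  constP : Carrier → Poly
  constP a = poly 1 (λ _ _ → a)

  mono : ℕ → ℕ → Poly
  mono a b' = poly (suc (a ℕ.⊔ b')) (λ i j → if (i ℕ.≡ᵇ a) ∧ (j ℕ.≡ᵇ b') then 1# else 0#)

  _+P_ : Poly → Poly → Poly
  f +P g = poly (deg f ℕ.⊔ deg g) (λ i j → coeff f i j + coeff g i j)

  -P_ : Poly → Poly
  -P f = poly (deg f) (λ i j → - coeff f i j)

  _-P_ : Poly → Poly → Poly
  f -P g = f +P (-P g)

  _·P_ : Carrier → Poly → Poly
  a ·P f = poly (deg f) (λ i j → a * coeff f i j)

  _*P_ : Poly → Poly → Poly
  f *P g = poly (deg f ℕ.+ deg g)
    (λ i j → sumTo (suc i) (λ a → sumTo (suc j) (λ a' →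
               coeff f a a' * coeff g (i ∸ a) (j ∸ a'))))

  powP : Poly → ℕ → Poly
  powP f zero    = constP 1#
  powP f (suc n) = f *P powP f n

  swapP : Poly → Poly
  swapP f = poly (deg f) (λ i j → coeff f j i)

  -- D_s(f) = (f - s f)/(η₁ - η₂), computed coefficientwise:
  -- coefficient of η₁^i η₂^j is Σ_{t ≤ min(i,j)} (f_{i+j+1-t, t} - f_{t, i+j+1-t})
  DsP : Poly → Poly
  DsP f = poly (deg f) (λ i j → sumTo (suc (i ℕ.⊓ j)) (λ t →
            coeff f (suc (i ℕ.+ j) ∸ t) t - coeff f t (suc (i ℕ.+ j) ∸ t)))

  η₁ η₂ ξ₁ ξ₂ δ : Poly
  η₁ = mono 1 0
  η₂ = mono 0 1
  ξ₁ = η₁ +P η₂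
  ξ₂ = η₁ *P η₂
  δ  = half ·P (η₁ -P η₂)

  -- matrix entries of 𝒜^nil(U) in the basis {1, δ}
  U11 U12 U21 U22 : Poly
  U11 = (half ·P (ξ₁ *P ξ₁)) -P ξ₂
  U12 = -P (ξ₁ *P (((half * half) ·P (ξ₁ *P ξ₁)) -P ξ₂))
  U21 = ξ₁
  U22 = -P U11

  -- 𝒜^nil(U) on P: write f = α + β δ with α = (f + s f)/2, β = D_s f
  -- (α, β symmetric) and apply the k[ξ₁,ξ₂]-linear map with the matrix above.
  UP : Poly → Poly
  UP f = (α *P (U11 +P (U21 *P δ))) +P (β *P (U12 +P (U22 *P δ)))
    where
      α = half ·P (f +P swapP f)
      β = DsP f

  -- P[ξ₂⁻¹]: elements  num / ξ₂^den
  record Loc : Set c where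
    constructor _/ξ₂^_
    field
      num : Poly
      den : ℕ

  open Loc public

  zeroL oneL : Loc
  zeroL = constP 0# /ξ₂^ 0
  oneL  = constP 1# /ξ₂^ 0

  _+L_ : Loc → Loc → Loc
  x +L y = ((powP ξ₂ (den y) *P num x) +P (powP ξ₂ (den x) *P num y)) /ξ₂^ (den x ℕ.+ den y)

  _·L_ : Carrier → Loc → Loc
  a ·L x = (a ·P num x) /ξ₂^ den x

  -- -D_s  (D_s is ξ₂-linear since ξ₂ is s-invariant)
  negDsL : Loc → Loc
  negDsL x = (-P DsP (num x)) /ξ₂^ den x

  -- 𝒜^nil(U) (k[ξ₁,ξ₂^{±1}]-linear)
  UL : Loc → Loc
  UL x = UP (num x) /ξ₂^ den x

  -- 𝒜^nil(U⁻¹) = ξ₂⁻² 𝒜^nil(U)   (since 𝒜^nil(U)² = ξ₂²)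
  UinvL : Loc → Loc
  UinvL x = UP (num x) /ξ₂^ (2 ℕ.+ den x)

  -- 𝒜^nil(S₀) = 𝒜^nil(U) 𝒜^nil(S) 𝒜^nil(U⁻¹)
  S0L : Loc → Loc
  S0L x = UL (negDsL (UinvL x))

  -- membership of f/ξ₂^n in the ideal of P[ξ₂⁻¹] generated by ξ₁ and ξ₂² - b
  -- (only the numerator matters up to powers of ξ₂)
  InIdeal : Poly → Set (c ⊔ ℓ)
  InIdeal g = ∃ λ N → ∃ λ a → ∃ λ a' →
    (powP ξ₂ N *P g) ≈P ((a *P ξ₁) +P (a' *P ((ξ₂ *P ξ₂) -P constP b)))

  -- equality in P[ξ₂⁻¹] ⊗ k, i.e. modulo (ξ₁, ξ₂² - b)
  _≈L_ : Loc → Loc → Set (c ⊔ ℓ)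
  x ≈L y = InIdeal ((powP ξ₂ (den y) *P num x) -P (powP ξ₂ (den x) *P num y))

  -- M_b = (P[ξ₂⁻¹] × P[ξ₂⁻¹]) ⊗_{k[ζ₁,ζ₂^{±1}]} k, ζ₁ ↦ 0, ζ₂ ↦ b
  -- (ζ₁ acts by -ξ₁ and ζ₂ by ξ₂² on both factors)
  M : Set c
  M = Loc × Loc

  _≈M_ : M → M → Set (c ⊔ ℓ)
  (x₁ , x₂) ≈M (y₁ , y₂) = (x₁ ≈L y₁) × (x₂ ≈L y₂)

  _+M_ : M → M → M
  (x₁ , x₂) +M (y₁ , y₂) = (x₁ +L y₁) , (x₂ +L y₂)

  _·M_ : Carrier → M → M
  a ·M (x₁ , x₂) = (a ·L x₁) , (a ·L x₂)

  -- the index set {1,2} is Fin 2 (zero ↦ 1, suc zero ↦ 2)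
  -- 𝒜₂(εⱼ) = pⱼ
  actε : Fin 2 → M → M
  actε Fin.zero       (x₁ , x₂) = x₁ , zeroL
  actε (Fin.suc _)    (x₁ , x₂) = zeroL , x₂

  -- 𝒜₂(S) = diag(-D_s) ∘ perm(s)
  actS : M → M
  actS (x₁ , x₂) = negDsL x₂ , negDsL x₁

  -- 𝒜₂(S₀) = diag(𝒜^nil(S₀)) ∘ perm(s₀), s₀ ↦ s in W₀
  actS0 : M → M
  actS0 (x₁ , x₂) = S0L x₂ , S0L x₁

  -- Elements of the subalgebra H_{2,aff} generated by ε₁, ε₂, S₀, S:
  -- (noncommutative) polynomial expressions in the generators.
  data AffExpr : Set c where
    gε   : Fin 2 → AffExpr
    gS   : AffExpr
    gS0  : AffExpr
    gsc  : Carrier → AffExpr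
    _⊕_  : AffExpr → AffExpr → AffExpr
    _⊛_  : AffExpr → AffExpr → AffExpr

  act : AffExpr → M → M
  act (gε j)  m = actε j m
  act gS      m = actS m
  act gS0     m = actS0 m
  act (gsc a) m = a ·M m
  act (h ⊕ h') m = act h m +M act h' m
  act (h ⊛ h') m = act h (act h' m)

  χ : Fin 2 → AffExpr → Carrier
  χ i (gε j) with Data.Fin._≟_ i j
  ... | Relation.Nullary.yes _ = 1#
  ... | Relation.Nullary.no _  = 0#
  χ i gS       = 0#
  χ i gS0      = 0#
  χ i (gsc a)  = a
  χ i (h ⊕ h') = χ i h + χ i h'
  χ i (h ⊛ h') = χ i h * χ i h'

  𝟙 : Fin 2 → M
  𝟙 Fin.zero       = oneL , zeroL
  𝟙 (Fin.suc _)    = zeroL , oneL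

module Submission where

-- M_b is a quotient of P[ξ₂⁻¹]², and the relation ≈L only uses
-- the generator ξ₁ of the ideal.  Call x ∈ P[ξ₂⁻¹] reduced to a ∈ k when
-- x ≡ a (mod ξ₁), i.e. its numerator is ≡ a ξ₂^d mod ξ₁ for d the
-- exponent of its denominator.  Modulo ξ₁ the generators act on such
-- elements very simply: D_s kills the symmetric polynomial a ξ₂^d and is
-- ξ₁-linear, so S (and hence S₀ = U S U⁻¹) sends everything to 0; the εⱼ
-- project.  So on pairs of reduced elements H_{2,aff} acts on the pair of
-- constants by χ₁ ⊕ χ₂, which applied to 1ᵢ gives the theorem.
--
-- To compute with the coefficient-function polynomials of the construction
-- we embed P in the ring 𝔹 = k[[η₁, η₂]] of power series, which is built
-- as a commutative ring so that the library's ring solver (instantiated with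
-- integer coefficients) applies.

open import Level using (Level; _⊔_)
open import Algebra.Bundles using (CommutativeRing; RawRing)
open import Algebra.Structures using (IsCommutativeRing)
import Algebra.Solver.Ring.AlmostCommutativeRing as ACR
open import Data.Nat as ℕ using (ℕ; zero; suc; _∸_; _<_; _≤_; _⊓_; _<ᵇ_)
import Data.Nat.Properties as ℕₚ
open import Data.Fin using (Fin; zero; suc)
open import Data.Bool using (true; false; if_then_else_; _∧_; T)
open import Data.Product using (_×_; _,_; proj₁; proj₂)
open import Data.Sum using (_⊎_; inj₁; inj₂)
import Data.Sum as Sum
open import Data.Maybe using (Maybe; just; nothing)
open import Data.Empty using (⊥-elim)
open import Relation.Nullary using (¬_; yes; no)
open import Relation.Binary.Definitions using (Tri; tri<; tri≈; tri>)
import Relation.Binary.PropositionalEquality as ≡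
open import Defs

module FiniteSums {c ℓ : Level} (A : CommutativeRing c ℓ) where
  open CommutativeRing A
  open RingHelpers A
  open import Relation.Binary.Reasoning.Setoid setoid

  sumTo-cong : ∀ n {f g : ℕ → Carrier} → (∀ a → a < n → f a ≈ g a) → sumTo n f ≈ sumTo n g
  sumTo-cong zero    f≈g = refl
  sumTo-cong (suc n) f≈g =
    +-cong (sumTo-cong n (λ a a<n → f≈g a (ℕₚ.m<n⇒m<1+n a<n))) (f≈g n (ℕₚ.n<1+n n))

  sumTo-cong′ : ∀ n {f g : ℕ → Carrier} → (∀ a → f a ≈ g a) → sumTo n f ≈ sumTo n g
  sumTo-cong′ n f≈g = sumTo-cong n (λ a _ → f≈g a)

  sumTo-zero : ∀ n {f : ℕ → Carrier} → (∀ a → a < n → f a ≈ 0#) → sumTo n f ≈ 0#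
  sumTo-zero zero    f≈0 = refl
  sumTo-zero (suc n) f≈0 = trans
    (+-cong (sumTo-zero n (λ a a<n → f≈0 a (ℕₚ.m<n⇒m<1+n a<n))) (f≈0 n (ℕₚ.n<1+n n)))
    (+-identityˡ 0#)

  sumTo-+ : ∀ n (f g : ℕ → Carrier) → sumTo n (λ a → f a + g a) ≈ sumTo n f + sumTo n g
  sumTo-+ zero    f g = sym (+-identityˡ 0#)
  sumTo-+ (suc n) f g = begin
    sumTo n (λ a → f a + g a) + (f n + g n) ≈⟨ +-congʳ (sumTo-+ n f g) ⟩
    (sumTo n f + sumTo n g) + (f n + g n)   ≈⟨ +-assoc _ _ _ ⟩
    sumTo n f + (sumTo n g + (f n + g n))   ≈⟨ +-congˡ (sym (+-assoc _ _ _)) ⟩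
    sumTo n f + ((sumTo n g + f n) + g n)   ≈⟨ +-congˡ (+-congʳ (+-comm _ _)) ⟩
    sumTo n f + ((f n + sumTo n g) + g n)   ≈⟨ +-congˡ (+-assoc _ _ _) ⟩
    sumTo n f + (f n + (sumTo n g + g n))   ≈⟨ sym (+-assoc _ _ _) ⟩
    (sumTo n f + f n) + (sumTo n g + g n)   ∎

  sumTo-*ˡ : ∀ n x (f : ℕ → Carrier) → x * sumTo n f ≈ sumTo n (λ a → x * f a)
  sumTo-*ˡ zero    x f = zeroʳ x
  sumTo-*ˡ (suc n) x f = trans (distribˡ x _ _) (+-congʳ (sumTo-*ˡ n x f))

  sumTo-head : ∀ n (f : ℕ → Carrier) → sumTo (suc n) f ≈ f 0 + sumTo n (λ a → f (suc a))
  sumTo-head zero    f = trans (+-identityˡ _) (sym (+-identityʳ _))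
  sumTo-head (suc n) f = trans (+-congʳ (sumTo-head n f)) (+-assoc _ _ _)

module PowerSeries {c ℓ : Level} (A : CommutativeRing c ℓ) where
  open CommutativeRing A
  open RingHelpers A
  open FiniteSums A
  open import Relation.Binary.Reasoning.Setoid setoid

  Series : Set c
  Series = ℕ → Carrier

  _≈ₛ_ : Series → Series → Set ℓ
  F ≈ₛ G = ∀ n → F n ≈ G n

  _+ₛ_ : Series → Series → Series
  (F +ₛ G) n = F n + G n

  -ₛ_ : Series → Series
  (-ₛ F) n = - F n

  _*ₛ_ : Series → Series → Series
  (F *ₛ G) n = sumTo (suc n) (λ a → F a * G (n ∸ a))

  const : Carrier → Series
  const a zero    = a
  const a (suc n) = 0#

  0ₛ 1ₛ : Series
  0ₛ _ = 0#
  1ₛ   = const 1#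

  shiftR : Series → Series
  shiftR F zero    = 0#
  shiftR F (suc n) = F n

  shiftL : Series → Series
  shiftL F n = F (suc n)

  *ₛ-cong : ∀ {F F′ G G′} → F ≈ₛ F′ → G ≈ₛ G′ → (F *ₛ G) ≈ₛ (F′ *ₛ G′)
  *ₛ-cong F≈ G≈ n = sumTo-cong′ (suc n) (λ a → *-cong (F≈ a) (G≈ (n ∸ a)))

  *ₛ-at-0 : ∀ F G → (F *ₛ G) 0 ≈ F 0 * G 0
  *ₛ-at-0 F G = +-identityˡ _

  *ₛ-unfoldˡ : ∀ F G n → (F *ₛ G) (suc n) ≈ F 0 * G (suc n) + (shiftL F *ₛ G) n
  *ₛ-unfoldˡ F G n = sumTo-head (suc n) (λ a → F a * G (suc n ∸ a))

  *ₛ-unfoldʳ : ∀ F G n → (F *ₛ G) (suc n) ≈ (F *ₛ shiftL G) n + F (suc n) * G 0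
  *ₛ-unfoldʳ F G n = +-cong
    (sumTo-cong (suc n) (λ a a<1+n →
      *-congˡ (reflexive (≡.cong G (ℕₚ.+-∸-assoc 1 (ℕₚ.≤-pred a<1+n))))))
    (*-congˡ (reflexive (≡.cong G (ℕₚ.n∸n≡0 n))))

  *ₛ-comm : ∀ F G → (F *ₛ G) ≈ₛ (G *ₛ F)
  *ₛ-comm F G zero    = trans (*ₛ-at-0 F G) (trans (*-comm _ _) (sym (*ₛ-at-0 G F)))
  *ₛ-comm F G (suc n) = begin
    (F *ₛ G) (suc n)                         ≈⟨ *ₛ-unfoldˡ F G n ⟩
    F 0 * G (suc n) + (shiftL F *ₛ G) n      ≈⟨ +-cong (*-comm _ _) (*ₛ-comm (shiftL F) G n) ⟩
    G (suc n) * F 0 + (G *ₛ shiftL F) n      ≈⟨ +-comm _ _ ⟩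
    (G *ₛ shiftL F) n + G (suc n) * F 0      ≈⟨ *ₛ-unfoldʳ G F n ⟨
    (G *ₛ F) (suc n)                         ∎

  *ₛ-distribʳ : ∀ F G H → ((F +ₛ G) *ₛ H) ≈ₛ ((F *ₛ H) +ₛ (G *ₛ H))
  *ₛ-distribʳ F G H n = trans (sumTo-cong′ (suc n) (λ a → distribʳ _ _ _)) (sumTo-+ (suc n) _ _)

  *ₛ-linearˡ : ∀ x F K G n → ((λ m → x * F m + K m) *ₛ G) n ≈ x * (F *ₛ G) n + (K *ₛ G) n
  *ₛ-linearˡ x F K G n = begin
    sumTo (suc n) (λ a → (x * F a + K a) * G (n ∸ a))
      ≈⟨ sumTo-cong′ (suc n) (λ a → trans (distribʳ _ _ _) (+-congʳ (*-assoc _ _ _))) ⟩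
    sumTo (suc n) (λ a → x * (F a * G (n ∸ a)) + K a * G (n ∸ a))
      ≈⟨ sumTo-+ (suc n) _ _ ⟩
    sumTo (suc n) (λ a → x * (F a * G (n ∸ a))) + (K *ₛ G) n
      ≈⟨ +-congʳ (sumTo-*ˡ (suc n) x _) ⟨
    x * (F *ₛ G) n + (K *ₛ G) n ∎

  *ₛ-assoc : ∀ F G H → ((F *ₛ G) *ₛ H) ≈ₛ (F *ₛ (G *ₛ H))
  *ₛ-assoc F G H zero = begin
    ((F *ₛ G) *ₛ H) 0       ≈⟨ *ₛ-at-0 (F *ₛ G) H ⟩
    (F *ₛ G) 0 * H 0        ≈⟨ *-congʳ (*ₛ-at-0 F G) ⟩
    (F 0 * G 0) * H 0       ≈⟨ *-assoc _ _ _ ⟩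
    F 0 * (G 0 * H 0)       ≈⟨ *-congˡ (*ₛ-at-0 G H) ⟨
    F 0 * (G *ₛ H) 0        ≈⟨ *ₛ-at-0 F (G *ₛ H) ⟨
    (F *ₛ (G *ₛ H)) 0       ∎
  *ₛ-assoc F G H (suc n) = begin
    ((F *ₛ G) *ₛ H) (suc n)
      ≈⟨ *ₛ-unfoldˡ (F *ₛ G) H n ⟩
    (F *ₛ G) 0 * H (suc n) + (shiftL (F *ₛ G) *ₛ H) n
      ≈⟨ +-cong (*-congʳ (*ₛ-at-0 F G)) (*ₛ-cong {G = H} (*ₛ-unfoldˡ F G) (λ _ → refl) n) ⟩
    (F 0 * G 0) * H (suc n) + ((λ m → F 0 * shiftL G m + (shiftL F *ₛ G) m) *ₛ H) n
      ≈⟨ +-cong (*-assoc _ _ _) (*ₛ-linearˡ (F 0) (shiftL G) (shiftL F *ₛ G) H n) ⟩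
    F 0 * (G 0 * H (suc n)) + (F 0 * (shiftL G *ₛ H) n + ((shiftL F *ₛ G) *ₛ H) n)
      ≈⟨ +-congˡ (+-congˡ (*ₛ-assoc (shiftL F) G H n)) ⟩
    F 0 * (G 0 * H (suc n)) + (F 0 * (shiftL G *ₛ H) n + (shiftL F *ₛ (G *ₛ H)) n)
      ≈⟨ +-assoc _ _ _ ⟨
    (F 0 * (G 0 * H (suc n)) + F 0 * (shiftL G *ₛ H) n) + (shiftL F *ₛ (G *ₛ H)) n
      ≈⟨ +-congʳ (distribˡ _ _ _) ⟨
    F 0 * (G 0 * H (suc n) + (shiftL G *ₛ H) n) + (shiftL F *ₛ (G *ₛ H)) n
      ≈⟨ +-congʳ (*-congˡ (*ₛ-unfoldˡ G H n)) ⟨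
    F 0 * (G *ₛ H) (suc n) + (shiftL F *ₛ (G *ₛ H)) n
      ≈⟨ *ₛ-unfoldˡ F (G *ₛ H) n ⟨
    (F *ₛ (G *ₛ H)) (suc n) ∎

  const-*ₛ : ∀ x G n → (const x *ₛ G) n ≈ x * G n
  const-*ₛ x G zero    = *ₛ-at-0 (const x) G
  const-*ₛ x G (suc n) = trans (*ₛ-unfoldˡ (const x) G n)
    (trans (+-congˡ (sumTo-zero (suc n) (λ a _ → zeroˡ _))) (+-identityʳ _))

  shiftR-*ₛ : ∀ F G n → (shiftR F *ₛ G) n ≈ shiftR (F *ₛ G) n
  shiftR-*ₛ F G zero    = trans (*ₛ-at-0 (shiftR F) G) (zeroˡ _)
  shiftR-*ₛ F G (suc n) = trans (*ₛ-unfoldˡ (shiftR F) G n) (trans (+-congʳ (zeroˡ _)) (+-identityˡ _))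

  1ₛ-*ₛ : ∀ G → (1ₛ *ₛ G) ≈ₛ G
  1ₛ-*ₛ G n = trans (const-*ₛ 1# G n) (*-identityˡ _)

  series-isCommutativeRing : IsCommutativeRing _≈ₛ_ _+ₛ_ _*ₛ_ -ₛ_ 0ₛ 1ₛ
  series-isCommutativeRing = record
    { isRing = record
      { +-isAbelianGroup = record
        { isGroup = record
          { isMonoid = record
            { isSemigroup = record
              { isMagma = record
                { isEquivalence = record
                  { refl  = λ n → refl
                  ; sym   = λ F≈G n → sym (F≈G n)
                  ; trans = λ F≈G G≈H n → trans (F≈G n) (G≈H n) }
                ; ∙-cong = λ F≈ G≈ n → +-cong (F≈ n) (G≈ n) }
              ; assoc = λ _ _ _ n → +-assoc _ _ _ }
            ; identity = (λ _ n → +-identityˡ _) , (λ _ n → +-identityʳ _) }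
          ; inverse = (λ _ n → -‿inverseˡ _) , (λ _ n → -‿inverseʳ _)
          ; ⁻¹-cong = λ F≈ n → -‿cong (F≈ n) }
        ; comm = λ _ _ n → +-comm _ _ }
      ; *-cong    = *ₛ-cong
      ; *-assoc   = *ₛ-assoc
      ; *-identity = 1ₛ-*ₛ , (λ G n → trans (*ₛ-comm G 1ₛ n) (1ₛ-*ₛ G n))
      ; distrib   = (λ F G H n → trans (*ₛ-comm F _ n)
                                   (trans (*ₛ-distribʳ G H F n) (+-cong (*ₛ-comm G F n) (*ₛ-comm H F n))))
                  , (λ F G H → *ₛ-distribʳ G H F)
      }
    ; *-comm = *ₛ-comm
    }

  powerSeriesRing : CommutativeRing c ℓ
  powerSeriesRing = record { isCommutativeRing = series-isCommutativeRing }

-- An integer is represented by a pair (a , b)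
-- standing for a - b, kept normalised (one component is zero) so that equal
-- integer coefficients are syntactically equal; it is interpreted as
-- natR a - natR b.
module IntegerSolver {c ℓ : Level} (R : CommutativeRing c ℓ) where
  open CommutativeRing R
  open RingHelpers R
  open import Relation.Binary.Reasoning.Setoid setoid
  open import Algebra.Properties.Ring ring using (-‿distribˡ-*; -‿distribʳ-*; -‿involutive; -‿anti-homo-+; -0#≈0#)

  ℤ₂ : Set
  ℤ₂ = ℕ × ℕ

  _⊖_ : ℕ → ℕ → ℤ₂
  a ⊖ b = (a ∸ b , b ∸ a)

  ℤ₂-rawRing : RawRing _ _
  ℤ₂-rawRing = record
    { Carrier = ℤ₂
    ; _≈_ = ≡._≡_
    ; _+_ = λ { (a , b) (a′ , b′) → (a ℕ.+ a′) ⊖ (b ℕ.+ b′) }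
    ; _*_ = λ { (a , b) (a′ , b′) → (a ℕ.* a′ ℕ.+ b ℕ.* b′) ⊖ (a ℕ.* b′ ℕ.+ b ℕ.* a′) }
    ; -_ = λ { (a , b) → (b , a) }
    ; 0# = (0 , 0)
    ; 1# = (1 , 0)
    }

  ⟦_⟧ℤ : ℤ₂ → Carrier
  ⟦ (a , b) ⟧ℤ = natR a - natR b

  natR-+ : ∀ m n → natR (m ℕ.+ n) ≈ natR m + natR n
  natR-+ zero    n = sym (+-identityˡ _)
  natR-+ (suc m) n = trans (+-congˡ (natR-+ m n)) (sym (+-assoc _ _ _))

  natR-* : ∀ m n → natR (m ℕ.* n) ≈ natR m * natR n
  natR-* zero    n = sym (zeroˡ _)
  natR-* (suc m) n = trans (natR-+ n (m ℕ.* n))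
    (trans (+-cong (sym (*-identityˡ _)) (natR-* m n)) (sym (distribʳ _ _ _)))

  sub-add : ∀ a b a′ b′ → (a - b) + (a′ - b′) ≈ (a + a′) - (b + b′)
  sub-add a b a′ b′ = begin
    (a + - b) + (a′ + - b′) ≈⟨ +-assoc _ _ _ ⟩
    a + (- b + (a′ + - b′)) ≈⟨ +-congˡ (sym (+-assoc _ _ _)) ⟩
    a + ((- b + a′) + - b′) ≈⟨ +-congˡ (+-congʳ (+-comm _ _)) ⟩
    a + ((a′ + - b) + - b′) ≈⟨ +-congˡ (+-assoc _ _ _) ⟩
    a + (a′ + (- b + - b′)) ≈⟨ sym (+-assoc _ _ _) ⟩
    (a + a′) + (- b + - b′) ≈⟨ +-congˡ (-‿anti-homo-+ b′ b) ⟨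
    (a + a′) + - (b′ + b)   ≈⟨ +-congˡ (-‿cong (+-comm _ _)) ⟩
    (a + a′) - (b + b′)     ∎

  mul-sub : ∀ a b a′ b′ → (a - b) * (a′ - b′) ≈ (a * a′ + b * b′) - (a * b′ + b * a′)
  mul-sub a b a′ b′ = begin
    (a + - b) * (a′ + - b′)                        ≈⟨ distribʳ _ _ _ ⟩
    a * (a′ + - b′) + - b * (a′ + - b′)            ≈⟨ +-cong (distribˡ _ _ _) (distribˡ _ _ _) ⟩
    (a * a′ + a * - b′) + (- b * a′ + - b * - b′)
      ≈⟨ +-cong (+-congˡ (sym (-‿distribʳ-* a b′))) (+-cong (sym (-‿distribˡ-* b a′)) neg-neg) ⟩
    (a * a′ - a * b′) + (- (b * a′) + b * b′)      ≈⟨ +-congˡ (+-comm _ _) ⟩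
    (a * a′ - a * b′) + (b * b′ - b * a′)          ≈⟨ sub-add _ _ _ _ ⟩
    (a * a′ + b * b′) - (a * b′ + b * a′)          ∎
    where
      neg-neg : - b * - b′ ≈ b * b′
      neg-neg = trans (sym (-‿distribˡ-* b (- b′)))
                      (trans (-‿cong (sym (-‿distribʳ-* b b′))) (-‿involutive _))

  ⊖-correct : ∀ a b → ⟦ a ⊖ b ⟧ℤ ≈ natR a - natR b
  ⊖-correct zero    zero    = refl
  ⊖-correct zero    (suc b) = refl
  ⊖-correct (suc a) zero    = refl
  ⊖-correct (suc a) (suc b) = trans (⊖-correct a b) (sym cancel-1)
    where
      cancel-1 : (1# + natR a) - (1# + natR b) ≈ natR a - natR b
      cancel-1 = begin
        (1# + natR a) - (1# + natR b)      ≈⟨ sub-add 1# 1# (natR a) (natR b) ⟨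
        (1# - 1#) + (natR a - natR b)      ≈⟨ +-congʳ (-‿inverseʳ 1#) ⟩
        0# + (natR a - natR b)             ≈⟨ +-identityˡ _ ⟩
        natR a - natR b                    ∎

  ⟦⟧ℤ-homomorphism : ℤ₂-rawRing ACR.-Raw-AlmostCommutative⟶ ACR.fromCommutativeRing R
  ⟦⟧ℤ-homomorphism = record
    { ⟦_⟧ = ⟦_⟧ℤ
    ; +-homo = λ { (a , b) (a′ , b′) → trans (⊖-correct (a ℕ.+ a′) (b ℕ.+ b′))
        (trans (+-cong (natR-+ a a′) (-‿cong (natR-+ b b′))) (sym (sub-add _ _ _ _))) }
    ; *-homo = λ { (a , b) (a′ , b′) →
        trans (⊖-correct (a ℕ.* a′ ℕ.+ b ℕ.* b′) (a ℕ.* b′ ℕ.+ b ℕ.* a′))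
          (trans (+-cong (trans (natR-+ (a ℕ.* a′) (b ℕ.* b′)) (+-cong (natR-* a a′) (natR-* b b′)))
                         (-‿cong (trans (natR-+ (a ℕ.* b′) (b ℕ.* a′)) (+-cong (natR-* a b′) (natR-* b a′)))))
                 (sym (mul-sub _ _ _ _))) }
    ; -‿homo = λ { (a , b) → sym (trans (-‿anti-homo-+ (natR a) (- natR b)) (+-congʳ (-‿involutive _))) }
    ; 0-homo = trans (+-identityˡ _) -0#≈0#
    ; 1-homo = trans (+-congʳ (+-identityʳ 1#)) (trans (+-congˡ -0#≈0#) (+-identityʳ 1#))
    }

  coefficient-equality : ∀ x y → Maybe (⟦ x ⟧ℤ ≈ ⟦ y ⟧ℤ)
  coefficient-equality (a , b) (a′ , b′) with a ℕₚ.≟ a′ | b ℕₚ.≟ b′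
  ... | yes ≡.refl | yes ≡.refl = just refl
  ... | _          | _          = nothing

  open import Algebra.Solver.Ring ℤ₂-rawRing (ACR.fromCommutativeRing R) ⟦⟧ℤ-homomorphism coefficient-equality public

-- The ring 𝔹 = k[[η₁, η₂]] of bivariate power series, built as series in η₁
-- over series in η₂; F i j is the coefficient of η₁^i η₂^j.  The key facts are  (η₁ - η₂) · D F = F - s F  and that
-- η₁ - η₂ is a non-zero-divisor, which together make D additive,
-- ξ₁-linear and zero on symmetric series.
module Bivariate {c ℓ : Level} (k : CommutativeRing c ℓ) where
  open CommutativeRing k hiding (zero)
  open RingHelpers k
  open FiniteSums k
  module 𝕊₁ = PowerSeries k
  module 𝕊₂ = PowerSeries 𝕊₁.powerSeriesRing

  𝔹 : CommutativeRing c ℓ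
  𝔹 = 𝕊₂.powerSeriesRing

  module 𝔹 = CommutativeRing 𝔹
  open 𝔹 public using ()
    renaming (Carrier to Bi; _+_ to _⊞_; _*_ to _⊠_; -_ to ⊟_; _-_ to _⊟_; _≈_ to _≋_; 0# to 𝟘; 1# to 𝟙ᴮ)
  module k-Solver = IntegerSolver k
  module 𝔹-Solver = IntegerSolver 𝔹
  open import Algebra.Properties.Ring ring using (-0#≈0#)
  open import Relation.Binary.Reasoning.Setoid setoid

  X₁ X₂ Δ Ξ₁ Ξ₂ : Bi
  X₁ = 𝕊₂.shiftR 𝟙ᴮ
  X₂ = 𝕊₂.const (𝕊₁.shiftR 𝕊₁.1ₛ)
  Δ  = X₁ ⊟ X₂
  Ξ₁ = X₁ ⊞ X₂
  Ξ₂ = X₁ ⊠ X₂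

  κ : Carrier → Bi
  κ a = 𝕊₂.const (𝕊₁.const a)

  Ξ₂^ : ℕ → Bi
  Ξ₂^ d = RingHelpers.pow 𝔹 Ξ₂ d

  X₁-⊠ : ∀ G i j → (X₁ ⊠ G) i j ≈ 𝕊₂.shiftR G i j
  X₁-⊠ G zero    j = 𝕊₂.shiftR-*ₛ 𝟙ᴮ G zero j
  X₁-⊠ G (suc i) j = trans (𝕊₂.shiftR-*ₛ 𝟙ᴮ G (suc i) j) (𝕊₂.1ₛ-*ₛ G i j)

  X₂-⊠ : ∀ G i j → (X₂ ⊠ G) i j ≈ 𝕊₁.shiftR (G i) j
  X₂-⊠ G i zero    = trans (𝕊₂.const-*ₛ _ G i zero) (𝕊₁.shiftR-*ₛ 𝕊₁.1ₛ (G i) zero)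
  X₂-⊠ G i (suc j) = trans (𝕊₂.const-*ₛ _ G i (suc j))
    (trans (𝕊₁.shiftR-*ₛ 𝕊₁.1ₛ (G i) (suc j)) (𝕊₁.1ₛ-*ₛ (G i) j))

  κ-⊠ : ∀ a G i j → (κ a ⊠ G) i j ≈ a * G i j
  κ-⊠ a G i j = trans (𝕊₂.const-*ₛ _ G i j) (𝕊₁.const-*ₛ a (G i) j)

  κ-cong : ∀ {a a′} → a ≈ a′ → κ a ≋ κ a′
  κ-cong a≈a′ zero    zero    = a≈a′
  κ-cong a≈a′ zero    (suc j) = refl
  κ-cong a≈a′ (suc i) j       = refl

  κ-0 : κ 0# ≋ 𝟘
  κ-0 zero    zero    = refl
  κ-0 zero    (suc j) = refl
  κ-0 (suc i) j       = refl

  κ-+ : ∀ a a′ → κ (a + a′) ≋ (κ a ⊞ κ a′)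
  κ-+ a a′ zero    zero    = refl
  κ-+ a a′ zero    (suc j) = sym (+-identityˡ _)
  κ-+ a a′ (suc i) j       = sym (+-identityˡ _)

  κ-neg : ∀ a → κ (- a) ≋ (⊟ κ a)
  κ-neg a zero    zero    = refl
  κ-neg a zero    (suc j) = sym -0#≈0#
  κ-neg a (suc i) j       = sym -0#≈0#

  κ-* : ∀ a a′ → κ (a * a′) ≋ (κ a ⊠ κ a′)
  κ-* a a′ i j = sym (trans (κ-⊠ a (κ a′) i j) (scale i j))
    where
      scale : ∀ i j → a * κ a′ i j ≈ κ (a * a′) i j
      scale zero    zero    = refl
      scale zero    (suc j) = zeroʳ a
      scale (suc i) j       = zeroʳ a

  κ0-⊠ : ∀ G → (κ 0# ⊠ G) ≋ 𝟘
  κ0-⊠ G = 𝔹.trans (𝔹.*-congʳ {G} κ-0) (𝔹.zeroˡ G)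

  Tr : Bi → Bi
  Tr F i j = F j i

  Tr-cong : ∀ {A B} → A ≋ B → Tr A ≋ Tr B
  Tr-cong A≋B i j = A≋B j i

  Tr-X₁ : ∀ G → Tr (X₁ ⊠ G) ≋ (X₂ ⊠ Tr G)
  Tr-X₁ G i zero    = trans (X₁-⊠ G zero i) (sym (X₂-⊠ (Tr G) i zero))
  Tr-X₁ G i (suc j) = trans (X₁-⊠ G (suc j) i) (sym (X₂-⊠ (Tr G) i (suc j)))

  Tr-X₂ : ∀ G → Tr (X₂ ⊠ G) ≋ (X₁ ⊠ Tr G)
  Tr-X₂ G zero    j = trans (X₂-⊠ G j zero) (sym (X₁-⊠ (Tr G) zero j))
  Tr-X₂ G (suc i) j = trans (X₂-⊠ G j (suc i)) (sym (X₁-⊠ (Tr G) (suc i) j))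

  Tr-κ : ∀ a G → Tr (κ a ⊠ G) ≋ (κ a ⊠ Tr G)
  Tr-κ a G i j = trans (κ-⊠ a G j i) (sym (κ-⊠ a (Tr G) i j))

  Tr-𝟙 : Tr 𝟙ᴮ ≋ 𝟙ᴮ
  Tr-𝟙 zero    zero    = refl
  Tr-𝟙 zero    (suc j) = refl
  Tr-𝟙 (suc i) zero    = refl
  Tr-𝟙 (suc i) (suc j) = refl

  Tr-Ξ₁ : ∀ A → Tr (Ξ₁ ⊠ A) ≋ (Ξ₁ ⊠ Tr A)
  Tr-Ξ₁ A = 𝔹.trans (Tr-cong {Ξ₁ ⊠ A} (𝔹.distribʳ A X₁ X₂))
    (𝔹.trans (𝔹.+-cong (Tr-X₁ A) (Tr-X₂ A))
    (𝔹.trans (𝔹.+-comm (X₂ ⊠ Tr A) (X₁ ⊠ Tr A)) (𝔹.sym (𝔹.distribʳ (Tr A) X₁ X₂))))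

  Tr-Ξ₂ : ∀ A → Tr (Ξ₂ ⊠ A) ≋ (Ξ₂ ⊠ Tr A)
  Tr-Ξ₂ A = 𝔹.trans (Tr-cong {Ξ₂ ⊠ A} (𝔹.*-assoc X₁ X₂ A))
    (𝔹.trans (Tr-X₁ (X₂ ⊠ A)) (𝔹.trans (𝔹.*-congˡ {X₂} {Tr (X₂ ⊠ A)} (Tr-X₂ A))
    (𝔹.trans (𝔹.sym (𝔹.*-assoc X₂ X₁ (Tr A))) (𝔹.*-congʳ {Tr A} (𝔹.*-comm X₂ X₁)))))

  Tr-Ξ₂^ : ∀ d → Tr (Ξ₂^ d) ≋ Ξ₂^ d
  Tr-Ξ₂^ zero    = Tr-𝟙
  Tr-Ξ₂^ (suc d) = 𝔹.trans (Tr-Ξ₂ (Ξ₂^ d)) (𝔹.*-congˡ {Ξ₂} {Tr (Ξ₂^ d)} (Tr-Ξ₂^ d))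

  Ξ₂^-+ : ∀ m n → Ξ₂^ (m ℕ.+ n) ≋ (Ξ₂^ m ⊠ Ξ₂^ n)
  Ξ₂^-+ zero    n = 𝔹.sym (𝔹.*-identityˡ (Ξ₂^ n))
  Ξ₂^-+ (suc m) n = 𝔹.trans (𝔹.*-congˡ (Ξ₂^-+ m n)) (𝔹.sym (𝔹.*-assoc Ξ₂ (Ξ₂^ m) (Ξ₂^ n)))

  D : Bi → Bi
  D F i j = sumTo (suc (i ⊓ j)) (λ t → F (suc (i ℕ.+ j) ∸ t) t - F t (suc (i ℕ.+ j) ∸ t))

  D-cong : ∀ {A B} → A ≋ B → D A ≋ D B
  D-cong A≋B i j = sumTo-cong′ (suc (i ⊓ j))
    (λ t → +-cong (A≋B (suc (i ℕ.+ j) ∸ t) t) (-‿cong (A≋B t (suc (i ℕ.+ j) ∸ t))))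

  Δ-⊠ : ∀ G i j → (Δ ⊠ G) i j ≈ 𝕊₂.shiftR G i j - 𝕊₁.shiftR (G i) j
  Δ-⊠ G i j = trans (𝔹-Solver.solve 3 (λ a b g → (a 𝔹-Solver.:- b) 𝔹-Solver.:* g 𝔹-Solver.:= a 𝔹-Solver.:* g 𝔹-Solver.:- b 𝔹-Solver.:* g) 𝔹.refl X₁ X₂ G i j)
                    (+-cong (X₁-⊠ G i j) (-‿cong (X₂-⊠ G i j)))

  -- coefficientwise form of  (η₁ - η₂) · D F = F - s F : the sums defining
  -- the two shifted coefficients of D F differ by exactly one summand
  Δ-D-coeff : ∀ F i j → 𝕊₂.shiftR (D F) i j - 𝕊₁.shiftR (D F i) j ≈ F i j - F j i
  Δ-D-coeff F zero    zero    = trans (-‿inverseʳ 0#) (sym (-‿inverseʳ (F 0 0)))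
  Δ-D-coeff F zero    (suc j) = trans (+-identityˡ _) (trans (-‿cong (+-identityˡ _))
    (k-Solver.solve 2 (λ x y → k-Solver.:- (x k-Solver.:- y) k-Solver.:= y k-Solver.:- x) refl (F (suc j) 0) (F 0 (suc j))))
  Δ-D-coeff F (suc i) zero    = begin
    D F i 0 - 0#
      ≈⟨ +-congʳ (reflexive (≡.cong₂ (λ m n → sumTo (suc m) (λ t → F (suc n ∸ t) t - F t (suc n ∸ t)))
                                      (ℕₚ.⊓-zeroʳ i) (ℕₚ.+-identityʳ i))) ⟩
    sumTo 1 (λ t → F (suc i ∸ t) t - F t (suc i ∸ t)) - 0#
      ≈⟨ +-cong (+-identityˡ _) -0#≈0# ⟩
    (F (suc i) 0 - F 0 (suc i)) + 0#  ≈⟨ +-identityʳ _ ⟩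
    F (suc i) 0 - F 0 (suc i)         ∎
  Δ-D-coeff F (suc i) (suc j) = begin
    D F i (suc j) - D F (suc i) j
      ≈⟨ +-congʳ (sumTo-cong′ (suc (i ⊓ suc j))
           (λ t → reflexive (≡.cong (λ n → F (suc n ∸ t) t - F t (suc n ∸ t)) (ℕₚ.+-suc i j)))) ⟩
    Σ≤ (i ⊓ suc j) - Σ≤ (suc i ⊓ j)   ≈⟨ by-cases (ℕₚ.<-cmp i j) ⟩
    F (suc i) (suc j) - F (suc j) (suc i) ∎
    where
      open k-Solver using (solve; _:+_; _:-_; _:=_; :-_)
      N : ℕ
      N = suc (suc (i ℕ.+ j))
      E : ℕ → Carrier
      E t = F (N ∸ t) t - F t (N ∸ t)
      Σ≤ : ℕ → Carrier
      Σ≤ m = sumTo (suc m) E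
      N∸1+i : N ∸ suc i ≡.≡ suc j
      N∸1+i = ≡.trans (≡.cong (_∸ i) (≡.sym (ℕₚ.+-suc i j))) (ℕₚ.m+n∸m≡n i (suc j))
      N∸1+j : N ∸ suc j ≡.≡ suc i
      N∸1+j = ≡.trans (≡.cong (λ n → suc n ∸ j) (ℕₚ.+-comm i j))
                      (≡.trans (≡.cong (_∸ j) (≡.sym (ℕₚ.+-suc j i))) (ℕₚ.m+n∸m≡n j (suc i)))
      by-cases : Tri (i < j) (i ≡.≡ j) (j < i) → Σ≤ (i ⊓ suc j) - Σ≤ (suc i ⊓ j) ≈ F (suc i) (suc j) - F (suc j) (suc i)
      by-cases (tri< i<j _ _) = begin
        Σ≤ (i ⊓ suc j) - Σ≤ (suc i ⊓ j)
          ≈⟨ reflexive (≡.cong₂ (λ m m′ → Σ≤ m - Σ≤ m′)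
               (ℕₚ.m≤n⇒m⊓n≡m (ℕₚ.≤-trans (ℕₚ.n≤1+n i) (ℕₚ.m≤n⇒m≤1+n i<j))) (ℕₚ.m≤n⇒m⊓n≡m i<j)) ⟩
        Σ≤ i - (Σ≤ i + E (suc i))
          ≈⟨ solve 2 (λ s e → s :- (s :+ e) := :- e) refl (Σ≤ i) (E (suc i)) ⟩
        - E (suc i)
          ≈⟨ solve 2 (λ x y → :- (x :- y) := y :- x) refl _ _ ⟩
        F (suc i) (N ∸ suc i) - F (N ∸ suc i) (suc i)
          ≈⟨ reflexive (≡.cong (λ n → F (suc i) n - F n (suc i)) N∸1+i) ⟩
        F (suc i) (suc j) - F (suc j) (suc i) ∎
      by-cases (tri≈ _ ≡.refl _) = begin
        Σ≤ (i ⊓ suc i) - Σ≤ (suc i ⊓ i)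
          ≈⟨ reflexive (≡.cong₂ (λ m m′ → Σ≤ m - Σ≤ m′) (ℕₚ.m≤n⇒m⊓n≡m (ℕₚ.n≤1+n i)) (ℕₚ.m≥n⇒m⊓n≡n (ℕₚ.n≤1+n i))) ⟩
        Σ≤ i - Σ≤ i                          ≈⟨ -‿inverseʳ _ ⟩
        0#                                   ≈⟨ -‿inverseʳ _ ⟨
        F (suc i) (suc i) - F (suc i) (suc i) ∎
      by-cases (tri> _ _ j<i) = begin
        Σ≤ (i ⊓ suc j) - Σ≤ (suc i ⊓ j)
          ≈⟨ reflexive (≡.cong₂ (λ m m′ → Σ≤ m - Σ≤ m′)
               (ℕₚ.m≥n⇒m⊓n≡n j<i) (ℕₚ.m≥n⇒m⊓n≡n (ℕₚ.≤-trans (ℕₚ.n≤1+n j) (ℕₚ.m≤n⇒m≤1+n j<i)))) ⟩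
        (Σ≤ j + E (suc j)) - Σ≤ j
          ≈⟨ solve 2 (λ s e → (s :+ e) :- s := e) refl (Σ≤ j) (E (suc j)) ⟩
        F (N ∸ suc j) (suc j) - F (suc j) (N ∸ suc j)
          ≈⟨ reflexive (≡.cong (λ n → F n (suc j) - F (suc j) n) N∸1+j) ⟩
        F (suc i) (suc j) - F (suc j) (suc i) ∎

  Δ⊠D : ∀ F → (Δ ⊠ D F) ≋ (F ⊟ Tr F)
  Δ⊠D F i j = trans (Δ-⊠ (D F) i j) (Δ-D-coeff F i j)

  -- η₁ - η₂ is not a zero divisor in 𝔹: if (η₁ - η₂) G = 0 then the
  -- coefficients of G vanish, by induction along the anti-diagonals
  Δ-cancel : ∀ {A B} → (Δ ⊠ A) ≋ (Δ ⊠ B) → A ≋ B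
  Δ-cancel {A} {B} ΔA≋ΔB i j = x-y≈0⇒x≈y (vanish j i)
    where
      open k-Solver using (solve; _:+_; _:-_; _:=_)
      x-y≈0⇒x≈y : ∀ {x y} → x - y ≈ 0# → x ≈ y
      x-y≈0⇒x≈y {x} {y} x-y≈0 =
        trans (solve 2 (λ x y → x := (x :- y) :+ y) refl x y) (trans (+-congʳ x-y≈0) (+-identityˡ y))
      G : Bi
      G = A ⊟ B
      ΔG≋𝟘 : (Δ ⊠ G) ≋ 𝟘
      ΔG≋𝟘 = 𝔹.trans (𝔹-Solver.solve 3 (λ d a b → d 𝔹-Solver.:* (a 𝔹-Solver.:- b) 𝔹-Solver.:= d 𝔹-Solver.:* a 𝔹-Solver.:- d 𝔹-Solver.:* b) 𝔹.refl Δ A B)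
                     (𝔹.trans (𝔹.+-congʳ ΔA≋ΔB) (𝔹.-‿inverseʳ (Δ ⊠ B)))
      coeff-rec : ∀ i j → 𝕊₂.shiftR G i j - 𝕊₁.shiftR (G i) j ≈ 0#
      coeff-rec i j = trans (sym (Δ-⊠ G i j)) (ΔG≋𝟘 i j)
      vanish : ∀ j i → G i j ≈ 0#
      vanish zero    i = trans (sym (trans (+-congˡ -0#≈0#) (+-identityʳ _))) (coeff-rec (suc i) zero)
      vanish (suc j) i = trans (x-y≈0⇒x≈y (coeff-rec (suc i) (suc j))) (vanish j (suc i))

  D-+ : ∀ A B → D (A ⊞ B) ≋ (D A ⊞ D B)
  D-+ A B = Δ-cancel (𝔹.trans (Δ⊠D (A ⊞ B)) (𝔹.sym (𝔹.trans (𝔹.distribˡ Δ (D A) (D B))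
    (𝔹.trans (𝔹.+-cong (Δ⊠D A) (Δ⊠D B))
      (solve 4 (λ a b sa sb → (a :- sa) :+ (b :- sb) := (a :+ b) :- (sa :+ sb)) 𝔹.refl A B (Tr A) (Tr B))))))
    where open 𝔹-Solver using (solve; _:+_; _:-_; _:=_)

  D-linear : ∀ C → (∀ A → Tr (C ⊠ A) ≋ (C ⊠ Tr A)) → ∀ A → D (C ⊠ A) ≋ (C ⊠ D A)
  D-linear C C-sym A = Δ-cancel (𝔹.trans (Δ⊠D (C ⊠ A)) (𝔹.trans (𝔹.+-congˡ (𝔹.-‿cong (C-sym A)))
    (𝔹.sym (𝔹.trans (solve 3 (λ d k x → d :* (k :* x) := k :* (d :* x)) 𝔹.refl Δ C (D A))
      (𝔹.trans (𝔹.*-congˡ (Δ⊠D A)) (solve 3 (λ k a sa → k :* (a :- sa) := k :* a :- k :* sa) 𝔹.refl C A (Tr A)))))))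
    where open 𝔹-Solver using (solve; _:*_; _:-_; _:=_)

  D-symmetric : ∀ A → Tr A ≋ A → D A ≋ 𝟘
  D-symmetric A sA≋A = Δ-cancel (𝔹.trans (Δ⊠D A)
    (𝔹.trans (𝔹.+-congˡ (𝔹.-‿cong sA≋A)) (𝔹.trans (𝔹.-‿inverseʳ A) (𝔹.sym (𝔹.zeroʳ Δ)))))

OutOf : ℕ → ℕ → ℕ → Set
OutOf d i j = d ≤ i ⊎ d ≤ j

OutOf-mono : ∀ {d d′ i j} → d ≤ d′ → OutOf d′ i j → OutOf d i j
OutOf-mono d≤d′ = Sum.map (ℕₚ.≤-trans d≤d′) (ℕₚ.≤-trans d≤d′)

<ᵇ-false : ∀ x d → d ≤ x → (x <ᵇ d) ≡.≡ false
<ᵇ-false x d d≤x with x <ᵇ d in eq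
... | false = ≡.refl
... | true  = ⊥-elim (ℕₚ.<⇒≱ (ℕₚ.<ᵇ⇒< x d (≡.subst T (≡.sym eq) _)) d≤x)

∧-false⇒OutOf : ∀ i j d → ((i <ᵇ d) ∧ (j <ᵇ d)) ≡.≡ false → OutOf d i j
∧-false⇒OutOf i j d i,j∉ with i <ᵇ d in eq
... | false = inj₁ (ℕₚ.≮⇒≥ (λ i<d → ≡.subst T eq (ℕₚ.<⇒<ᵇ i<d)))
... | true  = inj₂ (ℕₚ.≮⇒≥ (λ j<d → ≡.subst T i,j∉ (ℕₚ.<⇒<ᵇ j<d)))

module PolynomialSemantics {c ℓ : Level} (k : CommutativeRing c ℓ) (half b : CommutativeRing.Carrier k) where
  open CommutativeRing k hiding (zero)
  open RingHelpers k
  open FiniteSums k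
  open Construction k half b
  open Bivariate k
  open import Algebra.Properties.Ring ring using (-0#≈0#)
  open import Relation.Binary.Reasoning.Setoid setoid

  ⟦_⟧ : Poly → Bi
  ⟦ f ⟧ i j = coeff f i j

  coeff-out : ∀ f {i j} → OutOf (deg f) i j → coeff f i j ≈ 0#
  coeff-out f {i} {j} (inj₁ d≤i) =
    reflexive (≡.cong (λ z → if z ∧ (j <ᵇ deg f) then cf f i j else 0#) (<ᵇ-false i (deg f) d≤i))
  coeff-out f {i} {j} (inj₂ d≤j) with i <ᵇ deg f
  ... | false = refl
  ... | true  = reflexive (≡.cong (λ z → if z then cf f i j else 0#) (<ᵇ-false j (deg f) d≤j))

  coeff-poly : ∀ d (h H : ℕ → ℕ → Carrier) →
    (∀ i j → OutOf d i j → 0# ≈ H i j) → (∀ i j → h i j ≈ H i j) → ⟦ poly d h ⟧ 𝔹.≈ H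
  coeff-poly d h H out h≈H i j = by-box ((i <ᵇ d) ∧ (j <ᵇ d)) ≡.refl
    where
      by-box : ∀ t → t ≡.≡ ((i <ᵇ d) ∧ (j <ᵇ d)) → (if t then h i j else 0#) ≈ H i j
      by-box true  _  = h≈H i j
      by-box false eq = out i j (∧-false⇒OutOf i j d (≡.sym eq))

  sem-const : ∀ a → ⟦ constP a ⟧ ≋ κ a
  sem-const a zero    zero    = refl
  sem-const a zero    (suc j) = refl
  sem-const a (suc i) j       = refl

  sem-η₁ : ⟦ η₁ ⟧ ≋ X₁
  sem-η₁ zero          zero          = refl
  sem-η₁ zero          (suc zero)    = refl
  sem-η₁ zero          (suc (suc j)) = refl
  sem-η₁ (suc zero)    zero          = refl
  sem-η₁ (suc zero)    (suc zero)    = refl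
  sem-η₁ (suc zero)    (suc (suc j)) = refl
  sem-η₁ (suc (suc i)) j             = refl

  sem-η₂ : ⟦ η₂ ⟧ ≋ X₂
  sem-η₂ zero          zero          = refl
  sem-η₂ zero          (suc zero)    = refl
  sem-η₂ zero          (suc (suc j)) = refl
  sem-η₂ (suc zero)    zero          = refl
  sem-η₂ (suc zero)    (suc zero)    = refl
  sem-η₂ (suc zero)    (suc (suc j)) = refl
  sem-η₂ (suc (suc i)) j             = refl

  sem-+ : ∀ f g → ⟦ f +P g ⟧ ≋ (⟦ f ⟧ ⊞ ⟦ g ⟧)
  sem-+ f g = coeff-poly _ _ _
    (λ i j out → sym (trans (+-cong (coeff-out f (OutOf-mono (ℕₚ.m≤m⊔n _ _) out))
                                    (coeff-out g (OutOf-mono (ℕₚ.m≤n⊔m _ _) out)))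
                            (+-identityˡ 0#)))
    (λ _ _ → refl)

  sem-neg : ∀ f → ⟦ -P f ⟧ ≋ (⊟ ⟦ f ⟧)
  sem-neg f = coeff-poly _ _ _ (λ i j out → sym (trans (-‿cong (coeff-out f out)) -0#≈0#)) (λ _ _ → refl)

  sem-sub : ∀ f g → ⟦ f -P g ⟧ ≋ (⟦ f ⟧ ⊟ ⟦ g ⟧)
  sem-sub f g = 𝔹.trans (sem-+ f (-P g)) (𝔹.+-congˡ (sem-neg g))

  sem-· : ∀ a f → ⟦ a ·P f ⟧ ≋ (κ a ⊠ ⟦ f ⟧)
  sem-· a f = coeff-poly _ _ _
    (λ i j out → sym (trans (κ-⊠ a ⟦ f ⟧ i j) (trans (*-congˡ (coeff-out f out)) (zeroʳ a))))
    (λ i j → sym (κ-⊠ a ⟦ f ⟧ i j))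

  sem-swap : ∀ f → ⟦ swapP f ⟧ ≋ Tr ⟦ f ⟧
  sem-swap f = coeff-poly _ _ _ (λ i j out → sym (coeff-out f (Sum.swap out))) (λ _ _ → refl)

  sem-* : ∀ f g → ⟦ f *P g ⟧ ≋ (⟦ f ⟧ ⊠ ⟦ g ⟧)
  sem-* f g = coeff-poly _ _ _ out (λ i j → sym (inner-sum (suc i) _ j))
    where
      inner-sum : ∀ n (h : ℕ → 𝕊₁.Series) j → RingHelpers.sumTo 𝕊₁.powerSeriesRing n h j ≈ sumTo n (λ a → h a j)
      inner-sum zero    h j = refl
      inner-sum (suc n) h j = +-congʳ (inner-sum n h j)
      split : ∀ m a → deg f ℕ.+ deg g ≤ m → deg f ≤ a ⊎ deg g ≤ m ∸ a
      split m a fg≤m with deg f ℕₚ.≤? a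
      ... | yes f≤a = inj₁ f≤a
      ... | no  f≰a = inj₂ (ℕₚ.m+n≤o⇒m≤o∸n (deg g) (ℕₚ.≤-trans
              (ℕₚ.≤-trans (ℕₚ.+-monoʳ-≤ (deg g) (ℕₚ.<⇒≤ (ℕₚ.≰⇒> f≰a))) (ℕₚ.≤-reflexive (ℕₚ.+-comm (deg g) (deg f)))) fg≤m))
      product-zero : ∀ {x y} → x ≈ 0# ⊎ y ≈ 0# → x * y ≈ 0#
      product-zero {x} {y} (inj₁ x≈0) = trans (*-congʳ x≈0) (zeroˡ y)
      product-zero {x} {y} (inj₂ y≈0) = trans (*-congˡ y≈0) (zeroʳ x)
      out : ∀ i j → OutOf (deg f ℕ.+ deg g) i j → 0# ≈ (⟦ f ⟧ ⊠ ⟦ g ⟧) i j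
      out i j (inj₁ fg≤i) = sym (trans (inner-sum (suc i) _ j) (sumTo-zero (suc i) (λ a _ → sumTo-zero (suc j) (λ a′ _ →
        product-zero (Sum.map (λ f≤a → coeff-out f (inj₁ f≤a)) (λ g≤ → coeff-out g (inj₁ g≤)) (split i a fg≤i))))))
      out i j (inj₂ fg≤j) = sym (trans (inner-sum (suc i) _ j) (sumTo-zero (suc i) (λ a _ → sumTo-zero (suc j) (λ a′ _ →
        product-zero (Sum.map (λ f≤a′ → coeff-out f (inj₂ f≤a′)) (λ g≤ → coeff-out g (inj₂ g≤)) (split j a′ fg≤j))))))

  sem-Ds : ∀ f → ⟦ DsP f ⟧ ≋ D ⟦ f ⟧
  sem-Ds f = coeff-poly _ _ _ out (λ _ _ → refl)
    where
      dominates : ∀ i j t → t < suc (i ⊓ j) → i ≤ suc (i ℕ.+ j) ∸ t × j ≤ suc (i ℕ.+ j) ∸ t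
      dominates i j t t≤i⊓j =
          ℕₚ.m+n≤o⇒m≤o∸n i (ℕₚ.≤-trans (ℕₚ.+-monoʳ-≤ i (ℕₚ.≤-trans (ℕₚ.≤-pred t≤i⊓j) (ℕₚ.m⊓n≤n i j))) (ℕₚ.n≤1+n _))
        , ℕₚ.m+n≤o⇒m≤o∸n j (ℕₚ.≤-trans (ℕₚ.≤-trans (ℕₚ.+-monoʳ-≤ j (ℕₚ.≤-trans (ℕₚ.≤-pred t≤i⊓j) (ℕₚ.m⊓n≤m i j)))
                                                (ℕₚ.≤-reflexive (ℕₚ.+-comm j i))) (ℕₚ.n≤1+n _))
      beyond : ∀ {i j x} → OutOf (deg f) i j → i ≤ x × j ≤ x → deg f ≤ x
      beyond (inj₁ f≤i) (i≤x , _) = ℕₚ.≤-trans f≤i i≤x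
      beyond (inj₂ f≤j) (_ , j≤x) = ℕₚ.≤-trans f≤j j≤x
      out : ∀ i j → OutOf (deg f) i j → 0# ≈ D ⟦ f ⟧ i j
      out i j o = sym (sumTo-zero _ (λ t t≤ →
        trans (+-cong (coeff-out f (inj₁ (beyond o (dominates i j t t≤))))
                      (-‿cong (coeff-out f (inj₂ (beyond o (dominates i j t t≤))))))
              (trans (+-congˡ -0#≈0#) (+-identityʳ _))))

  sem-ξ₁ : ⟦ ξ₁ ⟧ ≋ Ξ₁
  sem-ξ₁ = 𝔹.trans (sem-+ η₁ η₂) (𝔹.+-cong sem-η₁ sem-η₂)

  sem-ξ₂ : ⟦ ξ₂ ⟧ ≋ Ξ₂
  sem-ξ₂ = 𝔹.trans (sem-* η₁ η₂) (𝔹.*-cong sem-η₁ sem-η₂)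

  sem-ξ₂^ : ∀ n → ⟦ powP ξ₂ n ⟧ ≋ Ξ₂^ n
  sem-ξ₂^ zero    = sem-const 1#
  sem-ξ₂^ (suc n) = 𝔹.trans (sem-* ξ₂ (powP ξ₂ n)) (𝔹.*-cong sem-ξ₂ (sem-ξ₂^ n))

-- A polynomial N reduces to the constant c in degree d
-- when N ≡ c ξ₂^d (mod ξ₁ P).  Such polynomials are closed under the ring
-- operations, the swap, D_s and 𝒜^nil(U); in particular -D_s sends every
-- one of them to 0 mod ξ₁ (D_s kills symmetric polynomials and is ξ₁-linear),
-- while U multiplies the constant by -1 (U ≡ -ξ₂ on symmetric polynomials).
module Reduction {c ℓ : Level} (k : CommutativeRing c ℓ) (half b : CommutativeRing.Carrier k)
                 (half-inverse : CommutativeRing._≈_ k (CommutativeRing._*_ k half (CommutativeRing._+_ k (CommutativeRing.1# k) (CommutativeRing.1# k))) (CommutativeRing.1# k)) where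
  open CommutativeRing k hiding (zero)
  open Construction k half b
  open Bivariate k
  open PolynomialSemantics k half b
  open 𝔹-Solver using (solve; _:+_; _:*_; _:-_; :-_; _:=_)
  open import Relation.Binary.Reasoning.Setoid 𝔹.setoid

  record ReducesTo (N : Poly) (a : Carrier) (d : ℕ) : Set (c ⊔ ℓ) where
    constructor _,_
    field
      cofactor  : Poly
      reduction : ⟦ N ⟧ ≋ (κ a ⊠ Ξ₂^ d ⊞ Ξ₁ ⊠ ⟦ cofactor ⟧)

  reduces-resp : ∀ {N a a′ d} → a ≈ a′ → ReducesTo N a d → ReducesTo N a′ d
  reduces-resp {d = d} a≈a′ (q , N≋) = q , 𝔹.trans N≋ (𝔹.+-congʳ (𝔹.*-congʳ {Ξ₂^ d} (κ-cong a≈a′)))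

  Ξ₁⊠⟦0⟧ : (Ξ₁ ⊠ ⟦ constP 0# ⟧) ≋ 𝟘
  Ξ₁⊠⟦0⟧ = 𝔹.trans (𝔹.*-congˡ {Ξ₁} (𝔹.trans (sem-const 0#) κ-0)) (𝔹.zeroʳ Ξ₁)

  reduces-const : ∀ a → ReducesTo (constP a) a 0
  reduces-const a = constP 0# , (begin
    ⟦ constP a ⟧                    ≈⟨ sem-const a ⟩
    κ a                             ≈⟨ 𝔹.*-identityʳ (κ a) ⟨
    κ a ⊠ 𝟙ᴮ                        ≈⟨ 𝔹.+-identityʳ _ ⟨
    κ a ⊠ 𝟙ᴮ ⊞ 𝟘                    ≈⟨ 𝔹.+-congˡ Ξ₁⊠⟦0⟧ ⟨
    κ a ⊠ 𝟙ᴮ ⊞ Ξ₁ ⊠ ⟦ constP 0# ⟧  ∎)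

  reduces-ξ₂^ : ∀ n → ReducesTo (powP ξ₂ n) 1# n
  reduces-ξ₂^ n = constP 0# , (begin
    ⟦ powP ξ₂ n ⟧                       ≈⟨ sem-ξ₂^ n ⟩
    Ξ₂^ n                               ≈⟨ 𝔹.*-identityˡ (Ξ₂^ n) ⟨
    κ 1# ⊠ Ξ₂^ n                        ≈⟨ 𝔹.+-identityʳ _ ⟨
    κ 1# ⊠ Ξ₂^ n ⊞ 𝟘                    ≈⟨ 𝔹.+-congˡ Ξ₁⊠⟦0⟧ ⟨
    κ 1# ⊠ Ξ₂^ n ⊞ Ξ₁ ⊠ ⟦ constP 0# ⟧  ∎)

  reduces-+ : ∀ {A B a a′ d} → ReducesTo A a d → ReducesTo B a′ d → ReducesTo (A +P B) (a + a′) d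
  reduces-+ {A} {B} {a} {a′} {d} (q , A≋) (q′ , B≋) = q +P q′ , (begin
    ⟦ A +P B ⟧                                                ≈⟨ sem-+ A B ⟩
    ⟦ A ⟧ ⊞ ⟦ B ⟧                                             ≈⟨ 𝔹.+-cong A≋ B≋ ⟩
    (κ a ⊠ Ξ₂^ d ⊞ Ξ₁ ⊠ ⟦ q ⟧) ⊞ (κ a′ ⊠ Ξ₂^ d ⊞ Ξ₁ ⊠ ⟦ q′ ⟧)
      ≈⟨ solve 6 (λ x x′ p y z z′ → (x :* p :+ y :* z) :+ (x′ :* p :+ y :* z′) := (x :+ x′) :* p :+ y :* (z :+ z′))
               𝔹.refl (κ a) (κ a′) (Ξ₂^ d) Ξ₁ ⟦ q ⟧ ⟦ q′ ⟧ ⟩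
    (κ a ⊞ κ a′) ⊠ Ξ₂^ d ⊞ Ξ₁ ⊠ (⟦ q ⟧ ⊞ ⟦ q′ ⟧)             ≈⟨ 𝔹.+-cong (𝔹.*-congʳ {Ξ₂^ d} (κ-+ a a′)) (𝔹.*-congˡ {Ξ₁} (sem-+ q q′)) ⟨
    κ (a + a′) ⊠ Ξ₂^ d ⊞ Ξ₁ ⊠ ⟦ q +P q′ ⟧                     ∎)

  reduces-neg : ∀ {A a d} → ReducesTo A a d → ReducesTo (-P A) (- a) d
  reduces-neg {A} {a} {d} (q , A≋) = -P q , (begin
    ⟦ -P A ⟧                                 ≈⟨ sem-neg A ⟩
    ⊟ ⟦ A ⟧                                  ≈⟨ 𝔹.-‿cong A≋ ⟩
    ⊟ (κ a ⊠ Ξ₂^ d ⊞ Ξ₁ ⊠ ⟦ q ⟧)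
      ≈⟨ solve 4 (λ x p y z → :- (x :* p :+ y :* z) := (:- x) :* p :+ y :* (:- z)) 𝔹.refl (κ a) (Ξ₂^ d) Ξ₁ ⟦ q ⟧ ⟩
    (⊟ κ a) ⊠ Ξ₂^ d ⊞ Ξ₁ ⊠ (⊟ ⟦ q ⟧)         ≈⟨ 𝔹.+-cong (𝔹.*-congʳ {Ξ₂^ d} (κ-neg a)) (𝔹.*-congˡ {Ξ₁} (sem-neg q)) ⟨
    κ (- a) ⊠ Ξ₂^ d ⊞ Ξ₁ ⊠ ⟦ -P q ⟧          ∎)

  reduces-· : ∀ {A a d} x → ReducesTo A a d → ReducesTo (x ·P A) (x * a) d
  reduces-· {A} {a} {d} x (q , A≋) = x ·P q , (begin
    ⟦ x ·P A ⟧                                ≈⟨ sem-· x A ⟩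
    κ x ⊠ ⟦ A ⟧                               ≈⟨ 𝔹.*-congˡ A≋ ⟩
    κ x ⊠ (κ a ⊠ Ξ₂^ d ⊞ Ξ₁ ⊠ ⟦ q ⟧)
      ≈⟨ solve 5 (λ w x p y z → w :* (x :* p :+ y :* z) := (w :* x) :* p :+ y :* (w :* z)) 𝔹.refl (κ x) (κ a) (Ξ₂^ d) Ξ₁ ⟦ q ⟧ ⟩
    (κ x ⊠ κ a) ⊠ Ξ₂^ d ⊞ Ξ₁ ⊠ (κ x ⊠ ⟦ q ⟧)  ≈⟨ 𝔹.+-cong (𝔹.*-congʳ {Ξ₂^ d} (κ-* x a)) (𝔹.*-congˡ {Ξ₁} (sem-· x q)) ⟨
    κ (x * a) ⊠ Ξ₂^ d ⊞ Ξ₁ ⊠ ⟦ x ·P q ⟧       ∎)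

  reduces-* : ∀ {A B a a′ d d′} → ReducesTo A a d → ReducesTo B a′ d′ → ReducesTo (A *P B) (a * a′) (d ℕ.+ d′)
  reduces-* {A} {B} {a} {a′} {d} {d′} (q , A≋) (q′ , B≋) = (q *P B) +P ((a ·P powP ξ₂ d) *P q′) , (begin
    ⟦ A *P B ⟧                                       ≈⟨ sem-* A B ⟩
    ⟦ A ⟧ ⊠ ⟦ B ⟧                                    ≈⟨ 𝔹.*-congʳ {⟦ B ⟧} A≋ ⟩
    (κ a ⊠ Ξ₂^ d ⊞ Ξ₁ ⊠ ⟦ q ⟧) ⊠ ⟦ B ⟧               ≈⟨ 𝔹.distribʳ ⟦ B ⟧ _ _ ⟩
    (κ a ⊠ Ξ₂^ d) ⊠ ⟦ B ⟧ ⊞ (Ξ₁ ⊠ ⟦ q ⟧) ⊠ ⟦ B ⟧    ≈⟨ 𝔹.+-congʳ (𝔹.*-congˡ {κ a ⊠ Ξ₂^ d} B≋) ⟩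
    (κ a ⊠ Ξ₂^ d) ⊠ (κ a′ ⊠ Ξ₂^ d′ ⊞ Ξ₁ ⊠ ⟦ q′ ⟧) ⊞ (Ξ₁ ⊠ ⟦ q ⟧) ⊠ ⟦ B ⟧
      ≈⟨ solve 8 (λ x x′ p p′ y z z′ w → (x :* p) :* (x′ :* p′ :+ y :* z′) :+ (y :* z) :* w
                                         := (x :* x′) :* (p :* p′) :+ y :* (z :* w :+ (x :* p) :* z′))
               𝔹.refl (κ a) (κ a′) (Ξ₂^ d) (Ξ₂^ d′) Ξ₁ ⟦ q ⟧ ⟦ q′ ⟧ ⟦ B ⟧ ⟩
    (κ a ⊠ κ a′) ⊠ (Ξ₂^ d ⊠ Ξ₂^ d′) ⊞ Ξ₁ ⊠ (⟦ q ⟧ ⊠ ⟦ B ⟧ ⊞ (κ a ⊠ Ξ₂^ d) ⊠ ⟦ q′ ⟧)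
      ≈⟨ 𝔹.+-cong (𝔹.*-cong (κ-* a a′) (Ξ₂^-+ d d′)) (𝔹.*-congˡ {Ξ₁} witness) ⟨
    κ (a * a′) ⊠ Ξ₂^ (d ℕ.+ d′) ⊞ Ξ₁ ⊠ ⟦ (q *P B) +P ((a ·P powP ξ₂ d) *P q′) ⟧ ∎)
    where
      witness : ⟦ (q *P B) +P ((a ·P powP ξ₂ d) *P q′) ⟧ ≋ (⟦ q ⟧ ⊠ ⟦ B ⟧ ⊞ (κ a ⊠ Ξ₂^ d) ⊠ ⟦ q′ ⟧)
      witness = 𝔹.trans (sem-+ (q *P B) ((a ·P powP ξ₂ d) *P q′))
        (𝔹.+-cong (sem-* q B) (𝔹.trans (sem-* (a ·P powP ξ₂ d) q′)
          (𝔹.*-congʳ {⟦ q′ ⟧} (𝔹.trans (sem-· a (powP ξ₂ d)) (𝔹.*-congˡ {κ a} (sem-ξ₂^ d))))))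

  zero-form : ∀ d Y → (κ 0# ⊠ Ξ₂^ d ⊞ Y) ≋ Y
  zero-form d Y = 𝔹.trans (𝔹.+-congʳ (κ0-⊠ (Ξ₂^ d))) (𝔹.+-identityˡ Y)

  reduces-swap : ∀ {N a d} → ReducesTo N a d → ReducesTo (swapP N) a d
  reduces-swap {N} {a} {d} (q , N≋) = swapP q , (begin
    ⟦ swapP N ⟧                               ≈⟨ sem-swap N ⟩
    Tr ⟦ N ⟧                                  ≈⟨ Tr-cong N≋ ⟩
    Tr (κ a ⊠ Ξ₂^ d) ⊞ Tr (Ξ₁ ⊠ ⟦ q ⟧)        ≈⟨ 𝔹.+-cong symmetric-part (Tr-Ξ₁ ⟦ q ⟧) ⟩
    κ a ⊠ Ξ₂^ d ⊞ Ξ₁ ⊠ Tr ⟦ q ⟧               ≈⟨ 𝔹.+-congˡ (𝔹.*-congˡ {Ξ₁} (sem-swap q)) ⟨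
    κ a ⊠ Ξ₂^ d ⊞ Ξ₁ ⊠ ⟦ swapP q ⟧            ∎)
    where
      symmetric-part : Tr (κ a ⊠ Ξ₂^ d) ≋ (κ a ⊠ Ξ₂^ d)
      symmetric-part = 𝔹.trans (Tr-κ a (Ξ₂^ d)) (𝔹.*-congˡ {κ a} (Tr-Ξ₂^ d))

  -- D_s kills the symmetric part c ξ₂^d and is ξ₁-linear
  reduces-Ds : ∀ {N a d} → ReducesTo N a d → ∀ e → ReducesTo (DsP N) 0# e
  reduces-Ds {N} {a} {d} (q , N≋) e = DsP q , (begin
    ⟦ DsP N ⟧                                 ≈⟨ sem-Ds N ⟩
    D ⟦ N ⟧                                   ≈⟨ D-cong N≋ ⟩
    D (κ a ⊠ Ξ₂^ d ⊞ Ξ₁ ⊠ ⟦ q ⟧)              ≈⟨ D-+ (κ a ⊠ Ξ₂^ d) (Ξ₁ ⊠ ⟦ q ⟧) ⟩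
    D (κ a ⊠ Ξ₂^ d) ⊞ D (Ξ₁ ⊠ ⟦ q ⟧)         ≈⟨ 𝔹.+-cong (D-symmetric _ symmetric-part) (D-linear Ξ₁ Tr-Ξ₁ ⟦ q ⟧) ⟩
    𝟘 ⊞ Ξ₁ ⊠ D ⟦ q ⟧                          ≈⟨ 𝔹.+-identityˡ _ ⟩
    Ξ₁ ⊠ D ⟦ q ⟧                              ≈⟨ 𝔹.*-congˡ {Ξ₁} (sem-Ds q) ⟨
    Ξ₁ ⊠ ⟦ DsP q ⟧                            ≈⟨ zero-form e _ ⟨
    κ 0# ⊠ Ξ₂^ e ⊞ Ξ₁ ⊠ ⟦ DsP q ⟧             ∎)
    where
      symmetric-part : Tr (κ a ⊠ Ξ₂^ d) ≋ (κ a ⊠ Ξ₂^ d)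
      symmetric-part = 𝔹.trans (Tr-κ a (Ξ₂^ d)) (𝔹.*-congˡ {κ a} (Tr-Ξ₂^ d))

  reduces-0-* : ∀ {A d} → ReducesTo A 0# d → ∀ B e → ReducesTo (A *P B) 0# e
  reduces-0-* {A} {d} (q , A≋) B e = q *P B , (begin
    ⟦ A *P B ⟧                                ≈⟨ sem-* A B ⟩
    ⟦ A ⟧ ⊠ ⟦ B ⟧                             ≈⟨ 𝔹.*-congʳ {⟦ B ⟧} (𝔹.trans A≋ (zero-form d _)) ⟩
    (Ξ₁ ⊠ ⟦ q ⟧) ⊠ ⟦ B ⟧                      ≈⟨ 𝔹.*-assoc Ξ₁ ⟦ q ⟧ ⟦ B ⟧ ⟩
    Ξ₁ ⊠ (⟦ q ⟧ ⊠ ⟦ B ⟧)                      ≈⟨ 𝔹.*-congˡ {Ξ₁} (sem-* q B) ⟨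
    Ξ₁ ⊠ ⟦ q *P B ⟧                           ≈⟨ zero-form e _ ⟨
    κ 0# ⊠ Ξ₂^ e ⊞ Ξ₁ ⊠ ⟦ q *P B ⟧            ∎)

  -- the first column of 𝒜^nil(U), i.e. U(1) = U₁₁ + U₂₁ δ, is ≡ -ξ₂ mod ξ₁
  first-column : ReducesTo (U11 +P (U21 *P δ)) (- 1#) 1
  first-column = (half ·P ξ₁) +P δ , (begin
    ⟦ U11 +P (U21 *P δ) ⟧                     ≈⟨ sem-+ U11 (U21 *P δ) ⟩
    ⟦ U11 ⟧ ⊞ ⟦ ξ₁ *P δ ⟧                     ≈⟨ 𝔹.+-cong U11-value (𝔹.trans (sem-* ξ₁ δ) (𝔹.*-congʳ {⟦ δ ⟧} sem-ξ₁)) ⟩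
    (κ half ⊠ (Ξ₁ ⊠ Ξ₁) ⊟ Ξ₂) ⊞ Ξ₁ ⊠ ⟦ δ ⟧
      ≈⟨ solve 4 (λ h x y δ′ → (h :* (x :* x) :- y) :+ x :* δ′ := (:- y) :+ x :* (h :* x :+ δ′)) 𝔹.refl (κ half) Ξ₁ Ξ₂ ⟦ δ ⟧ ⟩
    ⊟ Ξ₂ ⊞ Ξ₁ ⊠ (κ half ⊠ Ξ₁ ⊞ ⟦ δ ⟧)          ≈⟨ 𝔹.+-cong minus-ξ₂ (𝔹.*-congˡ {Ξ₁} witness) ⟨
    κ (- 1#) ⊠ Ξ₂^ 1 ⊞ Ξ₁ ⊠ ⟦ (half ·P ξ₁) +P δ ⟧ ∎)
    where
      open import Algebra.Properties.Ring 𝔹.ring using (-1*x≈-x)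
      U11-value : ⟦ U11 ⟧ ≋ (κ half ⊠ (Ξ₁ ⊠ Ξ₁) ⊟ Ξ₂)
      U11-value = 𝔹.trans (sem-sub (half ·P (ξ₁ *P ξ₁)) ξ₂)
        (𝔹.+-cong (𝔹.trans (sem-· half (ξ₁ *P ξ₁)) (𝔹.*-congˡ {κ half} (𝔹.trans (sem-* ξ₁ ξ₁) (𝔹.*-cong sem-ξ₁ sem-ξ₁))))
                  (𝔹.-‿cong sem-ξ₂))
      minus-ξ₂ : (κ (- 1#) ⊠ Ξ₂^ 1) ≋ (⊟ Ξ₂)
      minus-ξ₂ = 𝔹.trans (𝔹.*-cong (κ-neg 1#) (𝔹.*-identityʳ Ξ₂)) (-1*x≈-x Ξ₂)
      witness : ⟦ (half ·P ξ₁) +P δ ⟧ ≋ (κ half ⊠ Ξ₁ ⊞ ⟦ δ ⟧)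
      witness = 𝔹.trans (sem-+ (half ·P ξ₁) δ) (𝔹.+-congʳ (𝔹.trans (sem-· half ξ₁) (𝔹.*-congˡ {κ half} sem-ξ₁)))

  -- 𝒜^nil(U) multiplies the constant by -1 and raises the degree:
  -- on N = α + β δ (α the symmetrisation, β = D_s N) it acts by
  -- α U(1) + β U(δ), where α ≡ c ξ₂^d, U(1) ≡ -ξ₂ and β ≡ 0
  reduces-U : ∀ {N a d} → ReducesTo N a d → ReducesTo (UP N) (- a) (suc d)
  reduces-U {N} {a} {d} N↓ = ≡.subst (ReducesTo (UP N) (- a)) (ℕₚ.+-comm d 1)
    (reduces-resp constant
      (reduces-+ (reduces-* symmetrisation first-column)
                 (reduces-0-* (reduces-Ds N↓ 0) (U12 +P (U22 *P δ)) (d ℕ.+ 1))))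
    where
      open import Algebra.Properties.Ring ring using (-‿distribʳ-*)
      halving : half * (a + a) ≈ a
      halving = trans (*-congˡ (trans (+-cong (sym (*-identityˡ a)) (sym (*-identityˡ a))) (sym (distribʳ a 1# 1#))))
                      (trans (sym (*-assoc half (1# + 1#) a)) (trans (*-congʳ half-inverse) (*-identityˡ a)))
      symmetrisation : ReducesTo (half ·P (N +P swapP N)) (half * (a + a)) d
      symmetrisation = reduces-· half (reduces-+ N↓ (reduces-swap N↓))
      constant : half * (a + a) * - 1# + 0# ≈ - a
      constant = trans (+-identityʳ _) (trans (*-congʳ halving) (trans (sym (-‿distribʳ-* a 1#)) (-‿cong (*-identityʳ a))))

module Action {c ℓ : Level} (k : CommutativeRing c ℓ) (half b : CommutativeRing.Carrier k)
              (half-inverse : CommutativeRing._≈_ k (CommutativeRing._*_ k half (CommutativeRing._+_ k (CommutativeRing.1# k) (CommutativeRing.1# k))) (CommutativeRing.1# k)) where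
  open CommutativeRing k hiding (zero)
  open Construction k half b
  open Bivariate k
  open PolynomialSemantics k half b
  open Reduction k half b half-inverse
  open import Algebra.Properties.Ring ring using (-0#≈0#)

  Reduced : Loc → Carrier → Set (c ⊔ ℓ)
  Reduced x a = ReducesTo (num x) a (den x)

  zeroL-reduced : Reduced zeroL 0#
  zeroL-reduced = reduces-const 0#

  oneL-reduced : Reduced oneL 1#
  oneL-reduced = reduces-const 1#

  +L-reduced : ∀ {x y a a′} → Reduced x a → Reduced y a′ → Reduced (x +L y) (a + a′)
  +L-reduced {x} {y} x↓ y↓ = reduces-resp (+-cong (*-identityˡ _) (*-identityˡ _))
    (reduces-+ (≡.subst (ReducesTo _ _) (ℕₚ.+-comm (den y) (den x)) (reduces-* (reduces-ξ₂^ (den y)) x↓))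
               (reduces-* (reduces-ξ₂^ (den x)) y↓))

  negDsL-reduced : ∀ {x a} → Reduced x a → Reduced (negDsL x) 0#
  negDsL-reduced {x} x↓ = reduces-resp -0#≈0# (reduces-neg (reduces-Ds x↓ (den x)))

  -- S₀ = U S U⁻¹ : the middle factor -D_s already sends everything to 0
  S0L-reduced : ∀ {x a} → Reduced x a → Reduced (S0L x) 0#
  S0L-reduced {x} x↓ = reduces-resp -0#≈0#
    (reduces-U (reduces-resp -0#≈0# (reduces-neg (reduces-Ds (reduces-U x↓) (suc (den x))))))

  reduces-0⇒InIdeal : ∀ {g d} → ReducesTo g 0# d → InIdeal g
  reduces-0⇒InIdeal {g} {d} (q , g≋) = 0 , q , constP 0# , (begin
    ⟦ powP ξ₂ 0 *P g ⟧                    ≈⟨ sem-* (powP ξ₂ 0) g ⟩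
    ⟦ constP 1# ⟧ ⊠ ⟦ g ⟧                 ≈⟨ 𝔹.*-congʳ {⟦ g ⟧} (sem-const 1#) ⟩
    𝟙ᴮ ⊠ ⟦ g ⟧                            ≈⟨ 𝔹.*-identityˡ ⟦ g ⟧ ⟩
    ⟦ g ⟧                                 ≈⟨ 𝔹.trans g≋ (zero-form d _) ⟩
    Ξ₁ ⊠ ⟦ q ⟧                            ≈⟨ 𝔹.*-comm Ξ₁ ⟦ q ⟧ ⟩
    ⟦ q ⟧ ⊠ Ξ₁                            ≈⟨ 𝔹.trans (sem-* q ξ₁) (𝔹.*-congˡ {⟦ q ⟧} sem-ξ₁) ⟨
    ⟦ q *P ξ₁ ⟧                           ≈⟨ 𝔹.+-identityʳ _ ⟨
    ⟦ q *P ξ₁ ⟧ ⊞ 𝟘                       ≈⟨ 𝔹.+-congˡ (𝔹.trans (sem-* (constP 0#) Z) (𝔹.trans (𝔹.*-congʳ {⟦ Z ⟧} (sem-const 0#)) (κ0-⊠ ⟦ Z ⟧))) ⟨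
    ⟦ q *P ξ₁ ⟧ ⊞ ⟦ constP 0# *P Z ⟧      ≈⟨ sem-+ (q *P ξ₁) (constP 0# *P Z) ⟨
    ⟦ (q *P ξ₁) +P (constP 0# *P Z) ⟧     ∎)
    where
      open import Relation.Binary.Reasoning.Setoid 𝔹.setoid
      Z : Poly
      Z = (ξ₂ *P ξ₂) -P constP b

  reduced⇒≈L : ∀ {x a} r e → Reduced x a → a ≈ r * e → x ≈L (r ·L (constP e /ξ₂^ 0))
  reduced⇒≈L {x} {a} r e x↓ a≈re = reduces-0⇒InIdeal (reduces-resp difference-vanishes
    (reduces-+ (reduces-* (reduces-ξ₂^ 0) x↓)
               (reduces-neg (≡.subst (ReducesTo _ _) (ℕₚ.+-identityʳ (den x))
                 (reduces-* (reduces-ξ₂^ (den x)) (reduces-· r (reduces-const e)))))))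
    where
      difference-vanishes : 1# * a + - (1# * (r * e)) ≈ 0#
      difference-vanishes = trans (+-cong (*-identityˡ a) (-‿cong (trans (*-identityˡ _) (sym a≈re)))) (-‿inverseʳ a)

  χ₁ χ₂ : AffExpr → Carrier
  χ₁ = χ zero
  χ₂ = χ (suc zero)

  Reducedᴹ : Carrier → Carrier → M → Set (c ⊔ ℓ)
  Reducedᴹ a₁ a₂ m = Reduced (proj₁ m) a₁ × Reduced (proj₂ m) a₂

  Reducedᴹ-resp : ∀ {a₁ a₂ a₁′ a₂′ m} → a₁ ≈ a₁′ → a₂ ≈ a₂′ → Reducedᴹ a₁ a₂ m → Reducedᴹ a₁′ a₂′ m
  Reducedᴹ-resp a₁≈ a₂≈ (m₁↓ , m₂↓) = reduces-resp a₁≈ m₁↓ , reduces-resp a₂≈ m₂↓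

  act-reduced : ∀ h {a₁ a₂} m → Reducedᴹ a₁ a₂ m → Reducedᴹ (χ₁ h * a₁) (χ₂ h * a₂) (act h m)
  act-reduced (gε zero)       m (m₁↓ , m₂↓) =
    reduces-resp (sym (*-identityˡ _)) m₁↓ , reduces-resp (sym (zeroˡ _)) zeroL-reduced
  act-reduced (gε (suc zero)) m (m₁↓ , m₂↓) =
    reduces-resp (sym (zeroˡ _)) zeroL-reduced , reduces-resp (sym (*-identityˡ _)) m₂↓
  act-reduced gS              m (m₁↓ , m₂↓) =
    reduces-resp (sym (zeroˡ _)) (negDsL-reduced m₂↓) , reduces-resp (sym (zeroˡ _)) (negDsL-reduced m₁↓)
  act-reduced gS0             m (m₁↓ , m₂↓) =
    reduces-resp (sym (zeroˡ _)) (S0L-reduced m₂↓) , reduces-resp (sym (zeroˡ _)) (S0L-reduced m₁↓)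
  act-reduced (gsc r)         m (m₁↓ , m₂↓) = reduces-· r m₁↓ , reduces-· r m₂↓
  act-reduced (h ⊕ h′)        m m↓ with act-reduced h m m↓ | act-reduced h′ m m↓
  ... | (h₁↓ , h₂↓) | (h′₁↓ , h′₂↓) =
    reduces-resp (sym (distribʳ _ _ _)) (+L-reduced h₁↓ h′₁↓) , reduces-resp (sym (distribʳ _ _ _)) (+L-reduced h₂↓ h′₂↓)
  act-reduced (h ⊛ h′)        m m↓ =
    Reducedᴹ-resp (sym (*-assoc _ _ _)) (sym (*-assoc _ _ _)) (act-reduced h (act h′ m) (act-reduced h′ m m↓))

  𝟙-eigenvector : ∀ i h → act h (𝟙 i) ≈M (χ i h ·M 𝟙 i)
  𝟙-eigenvector zero h with act-reduced h (𝟙 zero) (oneL-reduced , zeroL-reduced)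
  ... | (m₁↓ , m₂↓) = reduced⇒≈L (χ₁ h) 1# m₁↓ refl , reduced⇒≈L (χ₁ h) 0# m₂↓ (trans (zeroʳ _) (sym (zeroʳ _)))
  𝟙-eigenvector (suc zero) h with act-reduced h (𝟙 (suc zero)) (zeroL-reduced , oneL-reduced)
  ... | (m₁↓ , m₂↓) = reduced⇒≈L (χ₂ h) 0# m₁↓ (trans (zeroʳ _) (sym (zeroʳ _))) , reduced⇒≈L (χ₂ h) 1# m₂↓ refl

mainTheorem9 : {c ℓ : Level} (k : CommutativeRing c ℓ) (p : ℕ) →
    IsAlgClosureOfFp k p →
    (half : CommutativeRing.Carrier k) →
    CommutativeRing._≈_ k (CommutativeRing._*_ k half (CommutativeRing._+_ k (CommutativeRing.1# k) (CommutativeRing.1# k))) (CommutativeRing.1# k) →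
    (b : CommutativeRing.Carrier k) → ¬ (CommutativeRing._≈_ k b (CommutativeRing.0# k)) →
    let open Construction k half b in
    (i : Fin 2) (h : AffExpr) → act h (𝟙 i) ≈M (χ i h ·M 𝟙 i)
mainTheorem9 k _ _ half half-inverse b _ = Action.𝟙-eigenvector k half b half-inverse
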